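{- Let $\mathcal{C}$ be a category, $F\colon\mathcal{C}\to\mathcal{C}$ a functor and $I$ an object of $\mathcal{C}$. (1) Every pointed coalgebra morphism $h\colon(C,c,i_C)\to(D,d,i_D)$ between pointed $F$-coalgebras that are both trees is an isomorphism. (2) If $\mathcal{C}$ has pullbacks and $F$ preserves pullbacks weakly (maps pullback squares to weak pullback squares), then every pointed $F$-coalgebra has at most one tree unravelling up to isomorphism: if $g\colon(T,t,i_T)\to(C,c,i_C)$ and $h\colon(S,s,i_S)\to(C,c,i_C)$ are pointed coalgebra morphisms whose domains are trees, then $(T,t,i_T)\cong(S,s,i_S)$ as pointed coalgebras.
   Context: A pointed $F$-coalgebra is $(C,c,i_C)$ with $c\colon C\to FC$, $i_C\colon I\to C$; a pointed coalgebra morphism $h\colon(C,c,i_C)\to(D,d,i_D)$ is $h\colon C\to D$ with $d\cdot h=Fh\cdot c$ and $h\cdot i_C=i_D$. A split epimorphism of pointed coalgebras is a pointed coalgebra morphism $h$ for which there is a pointed coalgebra morphism $s$ with $h\cdot s=\mathrm{id}$. A pointed coalgebra is a tree if every pointed coalgebra morphism into it (an unravelling) is a split epimorphism of pointed coalgebras. A tree unravelling of $(C,c,i_C)$ is a pointed coalgebra morphism into $(C,c,i_C)$ whose domain is a tree. -}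

module Defs where

open import Level using (Level; _⊔_; suc)
open import Data.Product using (Σ; Σ-syntax; _×_; _,_)
open import Relation.Binary.Structures using (IsEquivalence)

record Category (o ℓ e : Level) : Set (suc (o ⊔ ℓ ⊔ e)) where
  infix  4 _≈_
  infixr 9 _∘_
  field
    Obj       : Set o
    _⇒_       : Obj → Obj → Set ℓ
    _≈_       : ∀ {A B} → A ⇒ B → A ⇒ B → Set e
    id        : ∀ {A} → A ⇒ A
    _∘_       : ∀ {A B C} → B ⇒ C → A ⇒ B → A ⇒ C
    equiv     : ∀ {A B} → IsEquivalence (_≈_ {A} {B})
    assoc     : ∀ {A B C D} {f : A ⇒ B} {g : B ⇒ C} {h : C ⇒ D} →
                (h ∘ g) ∘ f ≈ h ∘ (g ∘ f)
    identityˡ : ∀ {A B} {f : A ⇒ B} → id ∘ f ≈ f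
    identityʳ : ∀ {A B} {f : A ⇒ B} → f ∘ id ≈ f
    ∘-resp-≈  : ∀ {A B C} {f h : B ⇒ C} {g i : A ⇒ B} →
                f ≈ h → g ≈ i → f ∘ g ≈ h ∘ i

record Endofunctor {o ℓ e : Level} (𝒞 : Category o ℓ e) : Set (o ⊔ ℓ ⊔ e) where
  open Category 𝒞
  field
    F₀           : Obj → Obj
    F₁           : ∀ {A B} → A ⇒ B → F₀ A ⇒ F₀ B
    identity     : ∀ {A} → F₁ (id {A}) ≈ id
    homomorphism : ∀ {A B C} {f : A ⇒ B} {g : B ⇒ C} →
                   F₁ (g ∘ f) ≈ F₁ g ∘ F₁ f
    F-resp-≈     : ∀ {A B} {f g : A ⇒ B} → f ≈ g → F₁ f ≈ F₁ g

module _ {o ℓ e : Level} (𝒞 : Category o ℓ e) where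
  open Category 𝒞

  record IsPullback {P A B C : Obj} (p₁ : P ⇒ A) (p₂ : P ⇒ B)
                    (f : A ⇒ C) (g : B ⇒ C) : Set (o ⊔ ℓ ⊔ e) where
    field
      commute   : f ∘ p₁ ≈ g ∘ p₂
      universal : ∀ {Q} (q₁ : Q ⇒ A) (q₂ : Q ⇒ B) → f ∘ q₁ ≈ g ∘ q₂ → Q ⇒ P
      p₁∘universal : ∀ {Q} {q₁ : Q ⇒ A} {q₂ : Q ⇒ B} (eq : f ∘ q₁ ≈ g ∘ q₂) →
                     p₁ ∘ universal q₁ q₂ eq ≈ q₁
      p₂∘universal : ∀ {Q} {q₁ : Q ⇒ A} {q₂ : Q ⇒ B} (eq : f ∘ q₁ ≈ g ∘ q₂) →
                     p₂ ∘ universal q₁ q₂ eq ≈ q₂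
      unique    : ∀ {Q} {q₁ : Q ⇒ A} {q₂ : Q ⇒ B} (eq : f ∘ q₁ ≈ g ∘ q₂) (u : Q ⇒ P) →
                  p₁ ∘ u ≈ q₁ → p₂ ∘ u ≈ q₂ → u ≈ universal q₁ q₂ eq

  record IsWeakPullback {P A B C : Obj} (p₁ : P ⇒ A) (p₂ : P ⇒ B)
                        (f : A ⇒ C) (g : B ⇒ C) : Set (o ⊔ ℓ ⊔ e) where
    field
      commute   : f ∘ p₁ ≈ g ∘ p₂
      universal : ∀ {Q} (q₁ : Q ⇒ A) (q₂ : Q ⇒ B) → f ∘ q₁ ≈ g ∘ q₂ →
                  Σ[ u ∈ Q ⇒ P ] (p₁ ∘ u ≈ q₁ × p₂ ∘ u ≈ q₂)

  HasPullbacks : Set (o ⊔ ℓ ⊔ e)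
  HasPullbacks = ∀ {A B C : Obj} (f : A ⇒ C) (g : B ⇒ C) →
                 Σ[ P ∈ Obj ] Σ[ p₁ ∈ P ⇒ A ] Σ[ p₂ ∈ P ⇒ B ] IsPullback p₁ p₂ f g

  PreservesPullbacksWeakly : Endofunctor 𝒞 → Set (o ⊔ ℓ ⊔ e)
  PreservesPullbacksWeakly F =
    ∀ {P A B C : Obj} {p₁ : P ⇒ A} {p₂ : P ⇒ B} {f : A ⇒ C} {g : B ⇒ C} →
    IsPullback p₁ p₂ f g → IsWeakPullback (F₁ p₁) (F₁ p₂) (F₁ f) (F₁ g)
    where open Endofunctor F

  module _ (F : Endofunctor 𝒞) (I : Obj) where
    open Endofunctor F

    record PointedCoalg : Set (o ⊔ ℓ) where
      field
        Carrier : Obj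
        str     : Carrier ⇒ F₀ Carrier
        point   : I ⇒ Carrier

    open PointedCoalg

    record PCHom (X Y : PointedCoalg) : Set (ℓ ⊔ e) where
      field
        arr      : Carrier X ⇒ Carrier Y
        commutes : str Y ∘ arr ≈ F₁ arr ∘ str X
        pointed  : arr ∘ point X ≈ point Y

    open PCHom

    IsSplitEpi : ∀ {X Y} → PCHom X Y → Set (ℓ ⊔ e)
    IsSplitEpi {X} {Y} h = Σ[ s ∈ PCHom Y X ] (arr h ∘ arr s ≈ id)

    IsTree : PointedCoalg → Set (o ⊔ ℓ ⊔ e)
    IsTree Y = ∀ (X : PointedCoalg) (h : PCHom X Y) → IsSplitEpi h

    IsIso : ∀ {X Y} → PCHom X Y → Set (ℓ ⊔ e)
    IsIso {X} {Y} h = Σ[ g ∈ PCHom Y X ] (arr h ∘ arr g ≈ id × arr g ∘ arr h ≈ id)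

    _≅_ : PointedCoalg → PointedCoalg → Set (ℓ ⊔ e)
    X ≅ Y = Σ[ h ∈ PCHom X Y ] IsIso h

{-# OPTIONS --safe #-}
-- (1) A morphism h : X → Y of trees has a section s (Y is a tree), and s in
-- turn has a section t (X is a tree). So s has left inverse h and right
-- inverse t, which forces h ≈ t and makes h invertible.
-- (2) Given unravellings T → C ← S, the pullback P of their carriers becomes a
-- coalgebra via a mediating map into the weak pullback F P, making both
-- projections pointed coalgebra morphisms. Splitting the projection onto the
-- tree T and following the other projection gives T → S, an iso by (1).
module Submission where

open import Defs
open import Level using (Level)
open import Data.Product using (Σ-syntax; _×_; _,_; proj₁; proj₂)
open import Relation.Binary.Bundles using (Setoid)
import Relation.Binary.Reasoning.Setoid as SetoidReasoning

module CategoryProperties {o ℓ e : Level} (𝒞 : Category o ℓ e) where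
  open Category 𝒞

  homSetoid : Obj → Obj → Setoid ℓ e
  homSetoid A B = record { Carrier = A ⇒ B ; _≈_ = _≈_ ; isEquivalence = equiv }

  module HomReasoning {A B : Obj} = SetoidReasoning (homSetoid A B)
  module HomEq {A B : Obj} = Setoid (homSetoid A B)
  open HomEq public using (refl; sym; trans)

  ∘-resp-≈ˡ : ∀ {A B C} {f h : B ⇒ C} {g : A ⇒ B} → f ≈ h → f ∘ g ≈ h ∘ g
  ∘-resp-≈ˡ f≈h = ∘-resp-≈ f≈h refl

  ∘-resp-≈ʳ : ∀ {A B C} {f : B ⇒ C} {g i : A ⇒ B} → g ≈ i → f ∘ g ≈ f ∘ i
  ∘-resp-≈ʳ g≈i = ∘-resp-≈ refl g≈i

  leftInverse≈rightInverse : ∀ {A B} {h t : A ⇒ B} {s : B ⇒ A} →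
                             h ∘ s ≈ id → s ∘ t ≈ id → h ≈ t
  leftInverse≈rightInverse {h = h} {t} {s} hs≈id st≈id = begin
    h            ≈⟨ sym identityʳ ⟩
    h ∘ id       ≈⟨ ∘-resp-≈ʳ (sym st≈id) ⟩
    h ∘ (s ∘ t)  ≈⟨ sym assoc ⟩
    (h ∘ s) ∘ t  ≈⟨ ∘-resp-≈ˡ hs≈id ⟩
    id ∘ t       ≈⟨ identityˡ ⟩
    t            ∎
    where open HomReasoning

module PointedCoalgebraProperties {o ℓ e : Level} (𝒞 : Category o ℓ e)
                                  (F : Endofunctor 𝒞) (I : Category.Obj 𝒞) where
  open Category 𝒞
  open Endofunctor F
  open CategoryProperties 𝒞
  open PointedCoalg
  open PCHom

  infixr 9 _∘ᴾ_
  _∘ᴾ_ : ∀ {X Y Z : PointedCoalg 𝒞 F I} →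
         PCHom 𝒞 F I Y Z → PCHom 𝒞 F I X Y → PCHom 𝒞 F I X Z
  _∘ᴾ_ {X} {Y} {Z} g f = record
    { arr      = arr g ∘ arr f
    ; commutes = begin
        str Z ∘ (arr g ∘ arr f)          ≈⟨ sym assoc ⟩
        (str Z ∘ arr g) ∘ arr f          ≈⟨ ∘-resp-≈ˡ (commutes g) ⟩
        (F₁ (arr g) ∘ str Y) ∘ arr f     ≈⟨ assoc ⟩
        F₁ (arr g) ∘ (str Y ∘ arr f)     ≈⟨ ∘-resp-≈ʳ (commutes f) ⟩
        F₁ (arr g) ∘ (F₁ (arr f) ∘ str X) ≈⟨ sym assoc ⟩
        (F₁ (arr g) ∘ F₁ (arr f)) ∘ str X ≈⟨ ∘-resp-≈ˡ (sym homomorphism) ⟩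
        F₁ (arr g ∘ arr f) ∘ str X       ∎
    ; pointed  = begin
        (arr g ∘ arr f) ∘ point X        ≈⟨ assoc ⟩
        arr g ∘ (arr f ∘ point X)        ≈⟨ ∘-resp-≈ʳ (pointed f) ⟩
        arr g ∘ point Y                  ≈⟨ pointed g ⟩
        point Z                          ∎
    }
    where open HomReasoning

  tree-hom-isIso : ∀ {X Y : PointedCoalg 𝒞 F I} →
                   IsTree 𝒞 F I X → IsTree 𝒞 F I Y →
                   (h : PCHom 𝒞 F I X Y) → IsIso 𝒞 F I h
  tree-hom-isIso {X} {Y} treeX treeY h with treeY X h
  ... | s , hs≈id with treeX Y s
  ... | t , st≈id =
    s , hs≈id , trans (∘-resp-≈ʳ (leftInverse≈rightInverse hs≈id st≈id)) st≈id

  module _ (pullbacks : HasPullbacks 𝒞) (weak : PreservesPullbacksWeakly 𝒞 F)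
           {C T S : PointedCoalg 𝒞 F I}
           (g : PCHom 𝒞 F I T C) (h : PCHom 𝒞 F I S C) where

    pullbackSpan : Σ[ P ∈ PointedCoalg 𝒞 F I ]
                   (PCHom 𝒞 F I P T × PCHom 𝒞 F I P S)
    pullbackSpan with pullbacks (arr g) (arr h)
    ... | P , p₁ , p₂ , isPullback =
      P̂ , record { arr = p₁ ; commutes = sym str-p₁ ; pointed = PB.p₁∘universal points-agree }
        , record { arr = p₂ ; commutes = sym str-p₂ ; pointed = PB.p₂∘universal points-agree }
      where
      module PB = IsPullback isPullback
      open HomReasoning

      cone-commutes : F₁ (arr g) ∘ (str T ∘ p₁) ≈ F₁ (arr h) ∘ (str S ∘ p₂)
      cone-commutes = begin
        F₁ (arr g) ∘ (str T ∘ p₁)  ≈⟨ sym assoc ⟩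
        (F₁ (arr g) ∘ str T) ∘ p₁  ≈⟨ ∘-resp-≈ˡ (sym (commutes g)) ⟩
        (str C ∘ arr g) ∘ p₁       ≈⟨ assoc ⟩
        str C ∘ (arr g ∘ p₁)       ≈⟨ ∘-resp-≈ʳ PB.commute ⟩
        str C ∘ (arr h ∘ p₂)       ≈⟨ sym assoc ⟩
        (str C ∘ arr h) ∘ p₂       ≈⟨ ∘-resp-≈ˡ (commutes h) ⟩
        (F₁ (arr h) ∘ str S) ∘ p₂  ≈⟨ assoc ⟩
        F₁ (arr h) ∘ (str S ∘ p₂)  ∎

      points-agree : arr g ∘ point T ≈ arr h ∘ point S
      points-agree = trans (pointed g) (sym (pointed h))

      str-P : Σ[ u ∈ P ⇒ F₀ P ] (F₁ p₁ ∘ u ≈ str T ∘ p₁ × F₁ p₂ ∘ u ≈ str S ∘ p₂)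
      str-P = IsWeakPullback.universal (weak isPullback) _ _ cone-commutes

      str-p₁ : F₁ p₁ ∘ proj₁ str-P ≈ str T ∘ p₁
      str-p₁ = proj₁ (proj₂ str-P)

      str-p₂ : F₁ p₂ ∘ proj₁ str-P ≈ str S ∘ p₂
      str-p₂ = proj₂ (proj₂ str-P)

      P̂ : PointedCoalg 𝒞 F I
      P̂ = record { Carrier = P
                 ; str     = proj₁ str-P
                 ; point   = PB.universal (point T) (point S) points-agree }

    hom-from-tree-unravelling : IsTree 𝒞 F I T → PCHom 𝒞 F I T S
    hom-from-tree-unravelling treeT with pullbackSpan
    ... | P , π₁ , π₂ = π₂ ∘ᴾ proj₁ (treeT P π₁)

open PointedCoalgebraProperties

lemma5p7 : ∀ {o ℓ e : Level} (𝒞 : Category o ℓ e) (F : Endofunctor 𝒞)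
    (I : Category.Obj 𝒞) →
    (∀ (X Y : PointedCoalg 𝒞 F I) →
    IsTree 𝒞 F I X → IsTree 𝒞 F I Y →
    (h : PCHom 𝒞 F I X Y) → IsIso 𝒞 F I h)
    ×
    (HasPullbacks 𝒞 → PreservesPullbacksWeakly 𝒞 F →
    ∀ (C T S : PointedCoalg 𝒞 F I) →
    IsTree 𝒞 F I T → IsTree 𝒞 F I S →
    PCHom 𝒞 F I T C → PCHom 𝒞 F I S C →
    _≅_ 𝒞 F I T S)
lemma5p7 𝒞 F I =
  (λ X Y → tree-hom-isIso 𝒞 F I) ,
  λ pullbacks weak C T S treeT treeS g h →
    let k = hom-from-tree-unravelling 𝒞 F I pullbacks weak g h treeT
    in k , tree-hom-isIso 𝒞 F I treeT treeS k
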